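{- For every $n\geq 0$, $h_{[-1,1]n}\leq P_F(n)\,b_{[-1,1]n}$, where $h_{[-1,1]n}$ is the number of $n$-step half-space walks and $b_{[-1,1]n}$ the number of $n$-step bridges on the strip $\mathbb{Z}\times\{ -1,0,1\}$ starting at $(0,0)$, and $P_F$ is as defined in the context.
   Context: A self-avoiding walk (SAW) of length $n$ on $\mathbb{Z}\times\{ -1,0,1\}$ is a sequence of distinct points $(w_0,\dots,w_n)$ of the strip, $w_i=(x_i,y_i)$, with $w_0=(0,0)$ and consecutive points at $\ell^1$-distance $1$. It is a half-space walk if $x_0<x_i$ for all $i=1,\dots,n$; by convention $h_{[-1,1]0}=1$. It is a bridge if $x_0<x_j\leq x_n$ for all $j>0$. For an integer $A>0$, $P_F(A)$ is the number of ways to write $A=A_1+\dots+A_k$ with integers $A_1>\dots>A_k>0$ and $k\leq 3$; by convention $P_F(0)=1$. -}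

module Defs where

open import Data.Nat using (ℕ; zero; suc)
import Data.Nat as ℕ
open import Data.Integer using (ℤ; +_; -[1+_]; _+_; _-_; _<_; _≤_; _≟_; _<?_; _≤?_)
open import Data.Product using (_×_; _,_; proj₁; proj₂)
open import Data.List using (List; []; _∷_; length; filter; map; concatMap; upTo)
open import Data.Nat.ListAction using (sum)
open import Data.Vec using (Vec; []; _∷_)
open import Relation.Nullary using (Dec; yes; no; ¬_)
open import Relation.Nullary.Decidable using (_×-dec_; ¬?)
open import Data.List.Relation.Unary.All using (All) renaming (all? to allL?)
open import Data.List.Relation.Unary.AllPairs using (AllPairs) renaming (allPairs? to allPairsL?)
import Relation.Binary.PropositionalEquality as Eq
open Eq using (_≡_)

Point : Set
Point = ℤ × ℤ

_≟P_ : (p q : Point) → Dec (p ≡ q)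
(a , b) ≟P (c , d) with a ≟ c | b ≟ d
... | yes Eq.refl | yes Eq.refl = yes Eq.refl
... | no ne | _ = no (λ { Eq.refl → ne Eq.refl })
... | _ | no ne = no (λ { Eq.refl → ne Eq.refl })

data Step : Set where
  E W N S : Step

move : Step → Point → Point
move E (x , y) = (x + + 1 , y)
move W (x , y) = (x - + 1 , y)
move N (x , y) = (x , y + + 1)
move S (x , y) = (x , y - + 1)

allSteps : (n : ℕ) → List (Vec Step n)
allSteps zero = [] ∷ []
allSteps (suc n) = concatMap (λ s → map (s ∷_) (allSteps n)) (E ∷ W ∷ N ∷ S ∷ [])

pointsFrom : ∀ {n} → Point → Vec Step n → List Point
pointsFrom p [] = []
pointsFrom p (s ∷ ss) = move s p ∷ pointsFrom (move s p) ss

origin : Point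
origin = (+ 0 , + 0)

walk : ∀ {n} → Vec Step n → List Point
walk ss = origin ∷ pointsFrom origin ss

last : Point → List Point → Point
last p [] = p
last p (q ∷ qs) = last q qs

endpoint : ∀ {n} → Vec Step n → Point
endpoint ss = last origin (pointsFrom origin ss)

inStrip : Point → Set
inStrip (x , y) = (-[1+ 0 ] ≤ y) × (y ≤ + 1)

inStrip? : (p : Point) → Dec (inStrip p)
inStrip? (x , y) = (-[1+ 0 ] ≤? y) ×-dec (y ≤? + 1)

IsSAW : ∀ {n} → Vec Step n → Set
IsSAW ss = All inStrip (walk ss) × AllPairs (λ p q → ¬ (p ≡ q)) (walk ss)

IsSAW? : ∀ {n} (ss : Vec Step n) → Dec (IsSAW ss)
IsSAW? ss = allL? inStrip? (walk ss) ×-dec allPairsL? (λ p q → ¬? (p ≟P q)) (walk ss)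

IsHalfSpace : ∀ {n} → Vec Step n → Set
IsHalfSpace ss = IsSAW ss × All (λ p → + 0 < proj₁ p) (pointsFrom origin ss)

IsHalfSpace? : ∀ {n} (ss : Vec Step n) → Dec (IsHalfSpace ss)
IsHalfSpace? ss = IsSAW? ss ×-dec allL? (λ p → + 0 <? proj₁ p) (pointsFrom origin ss)

IsBridge : ∀ {n} → Vec Step n → Set
IsBridge ss = IsSAW ss × All (λ p → (+ 0 < proj₁ p) × (proj₁ p ≤ proj₁ (endpoint ss))) (pointsFrom origin ss)

IsBridge? : ∀ {n} (ss : Vec Step n) → Dec (IsBridge ss)
IsBridge? ss = IsSAW? ss ×-dec allL? (λ p → (+ 0 <? proj₁ p) ×-dec (proj₁ p ≤? proj₁ (endpoint ss))) (pointsFrom origin ss)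

h : ℕ → ℕ
h n = length (filter IsHalfSpace? (allSteps n))

b : ℕ → ℕ
b n = length (filter IsBridge? (allSteps n))

-- Partitions into at most 3 distinct positive parts A₁ > … > A_k > 0.
-- Candidate lists: all lists of length ≤ 3 with entries in {1,…,A}.
listsUpTo : ℕ → ℕ → List (List ℕ)
listsUpTo A zero = [] ∷ []
listsUpTo A (suc k) = [] ∷ concatMap (λ a → map (a ∷_) (listsUpTo A k)) (map suc (upTo A))

IsDistinctPartition : ℕ → List ℕ → Set
IsDistinctPartition A xs = (sum xs ≡ A) × AllPairs (λ a c → c ℕ.< a) xs

IsDistinctPartition? : (A : ℕ) (xs : List ℕ) → Dec (IsDistinctPartition A xs)
IsDistinctPartition? A xs = (sum xs ℕ.≟ A) ×-dec allPairsL? (λ a c → c ℕ.<? a) xs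

-- P_F(A); for A = 0 only the empty list qualifies, giving P_F(0) = 1.
PF : ℕ → ℕ
PF A = length (filter (IsDistinctPartition? A) (listsUpTo A 3))

-- A half-space walk w of length n is unfolded into a bridge. Let n₁ be the last time at which the
-- x-coordinate of w attains its maximum M₁, and n₂ the last time in [n₁, n] at which it attains its
-- minimum m₂ over that interval. Reflecting the piece of w between n₁ and n₂ in the line x = M₁ and
-- translating the rest so that it continues the reflected piece gives a self-avoiding walk that stays
-- weakly left of x = M₁ up to time n₁, lies in (M₁, 2M₁ - m₂] up to n₂, and right of x = 2M₁ - m₂
-- afterwards. It is a bridge because after n₂ the walk w never goes right of its endpoint: otherwise
-- some vertical line would be visited four times, impossible in a strip of height three. Given M₁ and
-- M₁ - m₂, the times n₁ and n₂ are the last times the bridge lies weakly left of x = M₁ and of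
-- x = 2M₁ - m₂, so the unfolding can be undone. The numbers M₁, M₁ - m₂ and x_n - m₂ are strictly
-- decreasing while positive and sum to the width of the bridge, which is at most n; adding the
-- difference to M₁ yields a partition of n into at most three distinct parts, which together with
-- the bridge determines w.

module Submission where

open import Defs
open import Data.Nat using (ℕ; zero; suc; _+_; _*_; _∸_; _≤_; _<_; z≤n; s≤s; z<s; s<s; _≤?_; _<?_)
import Data.Nat.Properties as ℕP
open import Data.Nat.ListAction using (sum)
open import Data.Integer as ℤ using (ℤ; +_; -[1+_]; -_; ∣_∣; +≤+; -≤-)
import Data.Integer.Properties as ℤP
open import Data.Integer.Tactic.RingSolver using (solve-∀)
import Data.Nat.Tactic.RingSolver as ℕ-Ring
open import Data.Product using (_×_; _,_; proj₁; proj₂; ∃-syntax)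
open import Data.Sum as Sum using (_⊎_; inj₁; inj₂; [_,_]′)
open import Data.Empty using (⊥-elim)
open import Data.List using (List; []; _∷_; length; filter; map; applyUpTo; _++_; cartesianProduct)
open import Data.List.Properties using (length-++; length-map)
open import Data.List.Membership.Propositional using (_∈_; lose)
open import Data.List.Membership.Propositional.Properties
  using ( ∈-∃++; ∈-++⁻; ∈-++⁺ˡ; ∈-++⁺ʳ; ∈-map⁺; ∈-map⁻; ∈-concatMap⁺; ∈-upTo⁺; ∈-filter⁺; ∈-filter⁻
        ; ∈-cartesianProductWith⁺; ∈-cartesianProduct⁺)
open import Data.List.Relation.Binary.Subset.Propositional using (_⊆_)
open import Data.List.Relation.Unary.All as All using (All; []; _∷_)
import Data.List.Relation.Unary.All.Properties as AllP
open import Data.List.Relation.Unary.AllPairs using (AllPairs; []; _∷_)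
import Data.List.Relation.Unary.AllPairs.Properties as AllPairsP
open import Data.List.Relation.Unary.Any using (here; there)
open import Data.List.Relation.Unary.Linked using ([-]; _∷_)
open import Data.List.Relation.Unary.Linked.Properties using (Linked⇒AllPairs)
open import Data.List.Relation.Unary.Unique.Propositional using (Unique)
import Data.List.Relation.Unary.Unique.Propositional.Properties as UniqueP
open import Data.Vec using (Vec; []; _∷_)
import Data.Vec.Properties as VecP
open import Function using (_∘_)
open import Relation.Nullary using (yes; no)
open import Relation.Binary using (tri<; tri≈; tri>)
open import Relation.Binary.PropositionalEquality
  using (_≡_; _≢_; refl; sym; trans; cong; cong₂; subst; subst₂; module ≡-Reasoning)

-- Counting by injection

module _ {A : Set} where

  unique-⊆⇒length-≤ : {xs ys : List A} → Unique xs → xs ⊆ ys → length xs ≤ length ys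
  unique-⊆⇒length-≤ {[]}     _            _     = z≤n
  unique-⊆⇒length-≤ {x ∷ xs} (x∉xs ∷ uxs) xs⊆ys with ∈-∃++ (xs⊆ys (here refl))
  ... | ys₁ , ys₂ , refl = begin
    suc (length xs)                  ≤⟨ s≤s (unique-⊆⇒length-≤ uxs xs⊆ys₁++ys₂) ⟩
    suc (length (ys₁ ++ ys₂))        ≡⟨ cong suc (length-++ ys₁) ⟩
    suc (length ys₁ + length ys₂)    ≡⟨ ℕP.+-suc (length ys₁) (length ys₂) ⟨
    length ys₁ + length (x ∷ ys₂)    ≡⟨ length-++ ys₁ ⟨
    length (ys₁ ++ x ∷ ys₂)          ∎
    where
    open ℕP.≤-Reasoning
    xs⊆ys₁++ys₂ : xs ⊆ ys₁ ++ ys₂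
    xs⊆ys₁++ys₂ {y} y∈xs with ∈-++⁻ ys₁ (xs⊆ys (there y∈xs))
    ... | inj₁ y∈ys₁          = ∈-++⁺ˡ y∈ys₁
    ... | inj₂ (here refl)    = ⊥-elim (All.lookup x∉xs y∈xs refl)
    ... | inj₂ (there y∈ys₂)  = ∈-++⁺ʳ ys₁ y∈ys₂

module _ {A B : Set} {P : A → Set} (f : A → B)
         (f-injective : ∀ {x y} → P x → P y → f x ≡ f y → x ≡ y) where

  map⁺-injectiveOn : {xs : List A} → All P xs → Unique xs → Unique (map f xs)
  map⁺-injectiveOn []         []           = []
  map⁺-injectiveOn (px ∷ pxs) (x∉xs ∷ uxs) =
    AllP.map⁺ (All.zipWith (λ (py , x≢y) fx≡fy → x≢y (f-injective px py fx≡fy)) (pxs , x∉xs))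
    ∷ map⁺-injectiveOn pxs uxs

  injectiveOn⇒length-≤ : {xs : List A} {ys : List B} → All P xs → Unique xs →
                         (∀ {x} → x ∈ xs → f x ∈ ys) → length xs ≤ length ys
  injectiveOn⇒length-≤ {xs} {ys} pxs uxs f[xs]⊆ys = begin
    length xs         ≡⟨ length-map f xs ⟨
    length (map f xs) ≤⟨ unique-⊆⇒length-≤ (map⁺-injectiveOn pxs uxs) map-⊆ ⟩
    length ys         ∎
    where
    open ℕP.≤-Reasoning
    map-⊆ : map f xs ⊆ ys
    map-⊆ fx∈ with ∈-map⁻ f fx∈
    ... | x , x∈xs , refl = f[xs]⊆ys x∈xs

length-cartesianProduct : {A B : Set} (xs : List A) (ys : List B) →
                          length (cartesianProduct xs ys) ≡ length xs * length ys
length-cartesianProduct []       ys = refl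
length-cartesianProduct (x ∷ xs) ys = begin
  length (map (x ,_) ys ++ cartesianProduct xs ys)        ≡⟨ length-++ (map (x ,_) ys) ⟩
  length (map (x ,_) ys) + length (cartesianProduct xs ys) ≡⟨ cong₂ _+_ (length-map (x ,_) ys) (length-cartesianProduct xs ys) ⟩
  length ys + length xs * length ys                        ∎
  where open ≡-Reasoning

steps : List Step
steps = E ∷ W ∷ N ∷ S ∷ []

∈-steps : ∀ s → s ∈ steps
∈-steps E = here refl
∈-steps W = there (here refl)
∈-steps N = there (there (here refl))
∈-steps S = there (there (there (here refl)))

steps-unique : Unique steps
steps-unique = ((λ ()) ∷ (λ ()) ∷ (λ ()) ∷ []) ∷ ((λ ()) ∷ (λ ()) ∷ []) ∷ ((λ ()) ∷ []) ∷ [] ∷ []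

-- allSteps (suc n) is definitionally cartesianProductWith _∷_ steps (allSteps n).
allSteps-complete : ∀ {n} (ss : Vec Step n) → ss ∈ allSteps n
allSteps-complete []       = here refl
allSteps-complete (s ∷ ss) = ∈-cartesianProductWith⁺ _∷_ (∈-steps s) (allSteps-complete ss)

allSteps-unique : ∀ n → Unique (allSteps n)
allSteps-unique zero    = [] ∷ []
allSteps-unique (suc n) = UniqueP.cartesianProductWith⁺ _∷_ VecP.∷-injective steps-unique (allSteps-unique n)

-- Past the end of the vector stepAt returns E; that value never matters below.
stepAt : ∀ {n} → Vec Step n → ℕ → Step
stepAt []       _       = E
stepAt (s ∷ ss) zero    = s
stepAt (s ∷ ss) (suc j) = stepAt ss j

fromSteps : (n : ℕ) → (ℕ → Step) → Vec Step n
fromSteps zero    f = []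
fromSteps (suc n) f = f 0 ∷ fromSteps n (λ j → f (suc j))

stepAt-fromSteps : ∀ n f {j} → j < n → stepAt (fromSteps n f) j ≡ f j
stepAt-fromSteps (suc n) f {zero}  _         = refl
stepAt-fromSteps (suc n) f {suc j} (s<s j<n) = stepAt-fromSteps n (λ i → f (suc i)) j<n

stepAt-injective : ∀ {n} (u v : Vec Step n) → (∀ {j} → j < n → stepAt u j ≡ stepAt v j) → u ≡ v
stepAt-injective []      []      _   = refl
stepAt-injective (s ∷ u) (t ∷ v) u≗v = cong₂ _∷_ (u≗v z<s) (stepAt-injective u v (λ j<n → u≗v (s<s j<n)))

positionFrom : Point → (ℕ → Step) → ℕ → Point
positionFrom p f zero    = p
positionFrom p f (suc j) = positionFrom (move (f 0) p) (λ i → f (suc i)) j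

position : (ℕ → Step) → ℕ → Point
position = positionFrom origin

xAt : (ℕ → Step) → ℕ → ℤ
xAt f j = proj₁ (position f j)

positionFrom-suc : ∀ p f j → positionFrom p f (suc j) ≡ move (f j) (positionFrom p f j)
positionFrom-suc p f zero    = refl
positionFrom-suc p f (suc j) = positionFrom-suc (move (f 0) p) (λ i → f (suc i)) j

positionFrom-cong : ∀ {f g} p j → (∀ {i} → i < j → f i ≡ g i) → positionFrom p f j ≡ positionFrom p g j
positionFrom-cong p zero    _   = refl
positionFrom-cong p (suc j) f≗g rewrite f≗g z<s = positionFrom-cong _ j (λ i<j → f≗g (s<s i<j))

pointsFrom≡applyUpTo : ∀ {n} p (ss : Vec Step n) →
                       pointsFrom p ss ≡ applyUpTo (λ j → positionFrom p (stepAt ss) (suc j)) n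
pointsFrom≡applyUpTo p []       = refl
pointsFrom≡applyUpTo p (s ∷ ss) = cong (move s p ∷_) (pointsFrom≡applyUpTo (move s p) ss)

walk≡applyUpTo : ∀ {n} (ss : Vec Step n) → walk ss ≡ applyUpTo (position (stepAt ss)) (suc n)
walk≡applyUpTo ss = cong (origin ∷_) (pointsFrom≡applyUpTo origin ss)

last-pointsFrom : ∀ {n} p (ss : Vec Step n) → last p (pointsFrom p ss) ≡ positionFrom p (stepAt ss) n
last-pointsFrom p []       = refl
last-pointsFrom p (s ∷ ss) = last-pointsFrom (move s p) ss

record IsLastExtremum (_≼_ _≺_ : ℤ → ℤ → Set) (g : ℕ → ℤ) (lo n i : ℕ) : Set where
  field
    lo≤i    : lo ≤ i
    i≤n     : i ≤ n
    extreme : ∀ {j} → lo ≤ j → j ≤ n → g j ≼ g i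
    strict  : ∀ {j} → i < j → j ≤ n → g j ≺ g i

IsLastMax IsLastMin : (ℕ → ℤ) → ℕ → ℕ → ℕ → Set
IsLastMax = IsLastExtremum ℤ._≤_ ℤ._<_
IsLastMin = IsLastExtremum (λ x y → y ℤ.≤ x) (λ x y → y ℤ.< x)

≤-suc⁻ : ∀ {j n} → j ≤ suc n → j ≤ n ⊎ j ≡ suc n
≤-suc⁻ j≤1+n = Sum.map₁ ℕP.m<1+n⇒m≤n (ℕP.m≤n⇒m<n∨m≡n j≤1+n)

module _ (g : ℕ → ℤ) {lo n : ℕ} where

  lastMax-atEnd : lo ≤ suc n → (∀ {j} → lo ≤ j → j ≤ n → g j ℤ.≤ g (suc n)) → IsLastMax g lo (suc n) (suc n)
  lastMax-atEnd lo≤1+n before = record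
    { lo≤i    = lo≤1+n
    ; i≤n     = ℕP.≤-refl
    ; extreme = λ lo≤j j≤1+n → [ before lo≤j , (λ { refl → ℤP.≤-refl }) ]′ (≤-suc⁻ j≤1+n)
    ; strict  = λ i<j j≤i → ⊥-elim (ℕP.<⇒≱ i<j j≤i)
    }

  lastMax-extend : ∀ {i} → IsLastMax g lo n i → g (suc n) ℤ.< g i → IsLastMax g lo (suc n) i
  lastMax-extend m gn<gi = record
    { lo≤i    = lo≤i
    ; i≤n     = ℕP.m≤n⇒m≤1+n i≤n
    ; extreme = λ lo≤j j≤1+n → [ extreme lo≤j , (λ { refl → ℤP.<⇒≤ gn<gi }) ]′ (≤-suc⁻ j≤1+n)
    ; strict  = λ i<j j≤1+n → [ strict i<j , (λ { refl → gn<gi }) ]′ (≤-suc⁻ j≤1+n)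
    }
    where open IsLastExtremum m

lastMax-exists : (g : ℕ → ℤ) {lo n : ℕ} → lo ≤ n → ∃[ i ] IsLastMax g lo n i
lastMax-exists g {n = zero} z≤n = zero , record
  { lo≤i = z≤n ; i≤n = z≤n ; extreme = λ { _ z≤n → ℤP.≤-refl } ; strict = λ i<j j≤i → ⊥-elim (ℕP.<⇒≱ i<j j≤i) }
lastMax-exists g {lo} {suc n} lo≤1+n with lo ≤? n
... | no lo≰n = suc n , lastMax-atEnd g lo≤1+n (λ lo≤j j≤n → ⊥-elim (lo≰n (ℕP.≤-trans lo≤j j≤n)))
... | yes lo≤n with lastMax-exists g lo≤n
...   | i , m with g i ℤ.≤? g (suc n)
...     | yes gi≤gn = suc n , lastMax-atEnd g lo≤1+n (λ lo≤j j≤n → ℤP.≤-trans (IsLastExtremum.extreme m lo≤j j≤n) gi≤gn)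
...     | no gi≰gn  = i , lastMax-extend g m (ℤP.≰⇒> gi≰gn)

lastMin-exists : (g : ℕ → ℤ) {lo n : ℕ} → lo ≤ n → ∃[ i ] IsLastMin g lo n i
lastMin-exists g lo≤n with lastMax-exists (λ j → - g j) lo≤n
... | i , m = i , record
  { lo≤i    = lo≤i
  ; i≤n     = i≤n
  ; extreme = λ lo≤j j≤n → ℤP.neg-cancel-≤ (extreme lo≤j j≤n)
  ; strict  = λ i<j j≤n → ℤP.neg-cancel-< (strict i<j j≤n)
  }
  where open IsLastExtremum m

record AttainedWithin (g : ℕ → ℤ) (a b : ℕ) (c : ℤ) : Set where
  field
    time   : ℕ
    after  : a < time
    before : time < b
    value  : g time ≡ c

module _ (g : ℕ → ℤ) where

  ivt-≤ : (∀ j → g (suc j) ℤ.≤ ℤ.suc (g j)) →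
          ∀ {a b c} → a ≤ b → g a ℤ.≤ c → c ℤ.≤ g b → ∃[ j ] a ≤ j × j ≤ b × g j ≡ c
  ivt-≤ up {a} {b} {c} a≤b ga≤c c≤gb with ℕP.m≤n⇒m<n∨m≡n a≤b
  ... | inj₂ refl = a , ℕP.≤-refl , ℕP.≤-refl , ℤP.≤-antisym ga≤c c≤gb
  ... | inj₁ (s≤s {n = b′} a≤b′) with c ℤ.≤? g b′
  ...   | no c≰gb′  =
    b , a≤b , ℕP.≤-refl , ℤP.≤-antisym (ℤP.≤-trans (up b′) (ℤP.i<j⇒suc[i]≤j (ℤP.≰⇒> c≰gb′))) c≤gb
  ...   | yes c≤gb′ with ivt-≤ up a≤b′ ga≤c c≤gb′
  ...     | j , a≤j , j≤b′ , gj≡c = j , a≤j , ℕP.m≤n⇒m≤1+n j≤b′ , gj≡c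

  ivt-< : (∀ j → g (suc j) ℤ.≤ ℤ.suc (g j)) →
          ∀ {a b c} → a ≤ b → g a ℤ.< c → c ℤ.< g b → AttainedWithin g a b c
  ivt-< up a≤b ga<c c<gb with ivt-≤ up a≤b (ℤP.<⇒≤ ga<c) (ℤP.<⇒≤ c<gb)
  ... | j , a≤j , j≤b , gj≡c = record
    { time   = j
    ; after  = ℕP.≤∧≢⇒< a≤j (λ { refl → ℤP.<-irrefl gj≡c ga<c })
    ; before = ℕP.≤∧≢⇒< j≤b (λ { refl → ℤP.<-irrefl (sym gj≡c) c<gb })
    ; value  = gj≡c
    }

ivt-down-< : (g : ℕ → ℤ) → (∀ j → g j ℤ.≤ ℤ.suc (g (suc j))) →
             ∀ {a b c} → a ≤ b → g b ℤ.< c → c ℤ.< g a → AttainedWithin g a b c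
ivt-down-< g down {c = c} a≤b gb<c c<ga = record
  { AttainedWithin visit ; value = ℤP.neg-injective (AttainedWithin.value visit) }
  where
  -[1+x]+1≡-x : ∀ x → + 1 ℤ.+ - (+ 1 ℤ.+ x) ≡ - x
  -[1+x]+1≡-x = solve-∀
  up : ∀ j → - g (suc j) ℤ.≤ ℤ.suc (- g j)
  up j = subst (ℤ._≤ ℤ.suc (- g j)) (-[1+x]+1≡-x (g (suc j))) (ℤP.+-monoʳ-≤ (+ 1) (ℤP.neg-mono-≤ (down j)))
  visit : AttainedWithin (λ j → - g j) _ _ (- c)
  visit = ivt-< (λ j → - g j) up a≤b (ℤP.neg-mono-< c<ga) (ℤP.neg-mono-< gb<c)

record IsCrossing (g : ℕ → ℤ) (n : ℕ) (L : ℤ) (a : ℕ) : Set where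
  field
    a≤n   : a ≤ n
    below : ∀ {j} → j ≤ a → g j ℤ.≤ L
    above : ∀ {j} → a < j → j ≤ n → L ℤ.< g j

crossing-unique : ∀ {g n L a a′} → IsCrossing g n L a → IsCrossing g n L a′ → a ≡ a′
crossing-unique {a = a} {a′} c c′ with ℕP.<-cmp a a′
... | tri≈ _ a≡a′ _ = a≡a′
... | tri< a<a′ _ _ = ⊥-elim (ℤP.<⇒≱ (IsCrossing.above c a<a′ (IsCrossing.a≤n c′)) (IsCrossing.below c′ ℕP.≤-refl))
... | tri> _ _ a′<a = ⊥-elim (ℤP.<⇒≱ (IsCrossing.above c′ a′<a (IsCrossing.a≤n c)) (IsCrossing.below c ℕP.≤-refl))

crossing-separates : ∀ {g n L a i j} → IsCrossing g n L a → i ≤ a → a < j → j ≤ n → g i ≢ g j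
crossing-separates {L = L} c i≤a a<j j≤n gi≡gj =
  ℤP.<⇒≱ (IsCrossing.above c a<j j≤n) (subst (ℤ._≤ L) gi≡gj (IsCrossing.below c i≤a))

crossing-transport : ∀ {g g′ n L a} → (∀ {j} → j ≤ n → g j ≡ g′ j) → IsCrossing g n L a → IsCrossing g′ n L a
crossing-transport {L = L} g≗g′ c = record
  { a≤n   = a≤n
  ; below = λ j≤a → subst (ℤ._≤ L) (g≗g′ (ℕP.≤-trans j≤a a≤n)) (below j≤a)
  ; above = λ a<j j≤n → subst (L ℤ.<_) (g≗g′ j≤n) (above a<j j≤n)
  }
  where open IsCrossing c

-- Reflections and translations along the first coordinate

mirror : Step → Step
mirror E = W
mirror W = E
mirror N = N
mirror S = S

mirror-involutive : ∀ s → mirror (mirror s) ≡ s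
mirror-involutive E = refl
mirror-involutive W = refl
mirror-involutive N = refl
mirror-involutive S = refl

reflectX : ℤ → Point → Point
reflectX c (x , y) = (c ℤ.- x , y)

translateX : ℤ → Point → Point
translateX t (x , y) = (t ℤ.+ x , y)

reflectX-involutive : ∀ c p → reflectX c (reflectX c p) ≡ p
reflectX-involutive c (x , y) = cong (_, y) (c-[c-x]≡x c x)
  where
  c-[c-x]≡x : ∀ c x → c ℤ.- (c ℤ.- x) ≡ x
  c-[c-x]≡x = solve-∀

reflectX-injective : ∀ c {p q} → reflectX c p ≡ reflectX c q → p ≡ q
reflectX-injective c {p} {q} eq =
  trans (sym (reflectX-involutive c p)) (trans (cong (reflectX c) eq) (reflectX-involutive c q))

translateX-cancel : ∀ t p → translateX (- t) (translateX t p) ≡ p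
translateX-cancel t (x , y) = cong (_, y) (-t+[t+x]≡x t x)
  where
  -t+[t+x]≡x : ∀ t x → - t ℤ.+ (t ℤ.+ x) ≡ x
  -t+[t+x]≡x = solve-∀

translateX-injective : ∀ t {p q} → translateX t p ≡ translateX t q → p ≡ q
translateX-injective t {p} {q} eq =
  trans (sym (translateX-cancel t p)) (trans (cong (translateX (- t)) eq) (translateX-cancel t q))

move-reflectX : ∀ c s p → move (mirror s) (reflectX c p) ≡ reflectX c (move s p)
move-reflectX c E (x , y) = cong (_, y) (c-x-1≡c-[x+1] c x)
  where
  c-x-1≡c-[x+1] : ∀ c x → c ℤ.- x ℤ.- + 1 ≡ c ℤ.- (x ℤ.+ + 1)
  c-x-1≡c-[x+1] = solve-∀
move-reflectX c W (x , y) = cong (_, y) (c-x+1≡c-[x-1] c x)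
  where
  c-x+1≡c-[x-1] : ∀ c x → c ℤ.- x ℤ.+ + 1 ≡ c ℤ.- (x ℤ.- + 1)
  c-x+1≡c-[x-1] = solve-∀
move-reflectX c N (x , y) = refl
move-reflectX c S (x , y) = refl

move-translateX : ∀ t s p → move s (translateX t p) ≡ translateX t (move s p)
move-translateX t E (x , y) = cong (_, y) (ℤP.+-assoc t x (+ 1))
move-translateX t W (x , y) = cong (_, y) (ℤP.+-assoc t x (- + 1))
move-translateX t N (x , y) = refl
move-translateX t S (x , y) = refl

reflect-≤ : ∀ c {x y} → x ℤ.≤ y → c ℤ.- y ℤ.≤ c ℤ.- x
reflect-≤ c x≤y = ℤP.+-monoʳ-≤ c (ℤP.neg-mono-≤ x≤y)

reflect-< : ∀ c {x y} → x ℤ.< y → c ℤ.- y ℤ.< c ℤ.- x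
reflect-< c x<y = ℤP.+-monoʳ-< c (ℤP.neg-mono-< x<y)

i+i-i≡i : ∀ i → i ℤ.+ i ℤ.- i ≡ i
i+i-i≡i = solve-∀

i-j+j≡i : ∀ i j → i ℤ.- j ℤ.+ j ≡ i
i-j+j≡i = solve-∀

translate-≤ : ∀ L {m x} → m ℤ.≤ x → L ℤ.≤ L ℤ.- m ℤ.+ x
translate-≤ L {m} {x} m≤x = subst (ℤ._≤ L ℤ.- m ℤ.+ x) (i-j+j≡i L m) (ℤP.+-monoʳ-≤ (L ℤ.- m) m≤x)

translate-< : ∀ L {m x} → m ℤ.< x → L ℤ.< L ℤ.- m ℤ.+ x
translate-< L {m} {x} m<x = subst (ℤ._< L ℤ.- m ℤ.+ x) (i-j+j≡i L m) (ℤP.+-monoʳ-< (L ℤ.- m) m<x)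

0<i-j⇒j<i : ∀ {i j} → + 0 ℤ.< i ℤ.- j → j ℤ.< i
0<i-j⇒j<i {i} {j} 0<i-j = subst₂ ℤ._<_ (ℤP.+-identityˡ j) (i-j+j≡i i j) (ℤP.+-monoˡ-< j 0<i-j)

position-conjugate : (σ : Point → Point) (τ : Step → Step) → (∀ s p → move (τ s) (σ p) ≡ σ (move s p)) →
                     ∀ {f g a b} → (∀ {j} → a ≤ j → j < b → g j ≡ τ (f j)) →
                     position g a ≡ σ (position f a) →
                     ∀ {j} → a ≤ j → j ≤ b → position g j ≡ σ (position f j)
position-conjugate σ τ intertwine g≡τf start {zero}  z≤n     _      = start
position-conjugate σ τ intertwine {f} {g} g≡τf start {suc j} a≤1+j 1+j≤b with ≤-suc⁻ a≤1+j
... | inj₂ refl = start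
... | inj₁ a≤j  = begin
  position g (suc j)                ≡⟨ positionFrom-suc origin g j ⟩
  move (g j) (position g j)
    ≡⟨ cong₂ move (g≡τf a≤j 1+j≤b) (position-conjugate σ τ intertwine g≡τf start a≤j (ℕP.<⇒≤ 1+j≤b)) ⟩
  move (τ (f j)) (σ (position f j)) ≡⟨ intertwine (f j) (position f j) ⟩
  σ (move (f j) (position f j))     ≡⟨ cong σ (positionFrom-suc origin f j) ⟨
  σ (position f (suc j))            ∎
  where open ≡-Reasoning

x-move-≤ : ∀ s p → proj₁ (move s p) ℤ.≤ ℤ.suc (proj₁ p)
x-move-≤ E (x , y) = ℤP.≤-reflexive (ℤP.+-comm x (+ 1))
x-move-≤ W (x , y) = ℤP.≤-trans (ℤP.i-j≤i x (+ 1)) (ℤP.i≤j+i x (+ 1))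
x-move-≤ N (x , y) = ℤP.i≤j+i x (+ 1)
x-move-≤ S (x , y) = ℤP.i≤j+i x (+ 1)

x-move-≥ : ∀ s p → proj₁ p ℤ.≤ ℤ.suc (proj₁ (move s p))
x-move-≥ E (x , y) = ℤP.≤-trans (ℤP.i≤i+j x (+ 1)) (ℤP.i≤j+i (x ℤ.+ + 1) (+ 1))
x-move-≥ W (x , y) = ℤP.≤-reflexive (x≡1+[x-1] x)
  where
  x≡1+[x-1] : ∀ x → x ≡ + 1 ℤ.+ (x ℤ.- + 1)
  x≡1+[x-1] = solve-∀
x-move-≥ N (x , y) = ℤP.i≤j+i x (+ 1)
x-move-≥ S (x , y) = ℤP.i≤j+i x (+ 1)

xAt-suc-≤ : ∀ f j → xAt f (suc j) ℤ.≤ ℤ.suc (xAt f j)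
xAt-suc-≤ f j rewrite positionFrom-suc origin f j = x-move-≤ (f j) (position f j)

xAt-suc-≥ : ∀ f j → xAt f j ℤ.≤ ℤ.suc (xAt f (suc j))
xAt-suc-≥ f j rewrite positionFrom-suc origin f j = x-move-≥ (f j) (position f j)

xAt-≤-time : ∀ f j → xAt f j ℤ.≤ + j
xAt-≤-time f zero    = ℤP.≤-refl
xAt-≤-time f (suc j) = ℤP.≤-trans (xAt-suc-≤ f j) (ℤP.+-monoʳ-≤ (+ 1) (xAt-≤-time f j))

column : ℤ → List Point
column x = (x , -[1+ 0 ]) ∷ (x , + 0) ∷ (x , + 1) ∷ []

inStrip⇒∈column : ∀ {x y} → inStrip (x , y) → (x , y) ∈ column x
inStrip⇒∈column {y = -[1+ 0 ]}       _                    = here refl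
inStrip⇒∈column {y = + 0}            _                    = there (here refl)
inStrip⇒∈column {y = + 1}            _                    = there (there (here refl))
inStrip⇒∈column {y = -[1+ suc _ ]}   (-≤- () , _)
inStrip⇒∈column {y = + suc (suc _)}  (_ , +≤+ (s≤s ()))

applyUpTo-AllPairs⁻ : ∀ {A : Set} {R : A → A → Set} f n → AllPairs R (applyUpTo f n) →
                      ∀ {i j} → i < j → j < n → R (f i) (f j)
applyUpTo-AllPairs⁻ f (suc n) (Rf₀ ∷ _)   {zero}  {suc j} _         (s<s j<n) = AllP.applyUpTo⁻ (λ i → f (suc i)) n Rf₀ j<n
applyUpTo-AllPairs⁻ f (suc n) (_ ∷ Rfs)  {suc i} {suc j} (s<s i<j) (s<s j<n) =
  applyUpTo-AllPairs⁻ (λ i → f (suc i)) n Rfs i<j j<n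

module SelfAvoiding {n} {ss : Vec Step n} (saw : IsSAW ss) where

  private
    P = position (stepAt ss)

  positions-distinct : ∀ {i j} → i < j → j ≤ n → P i ≢ P j
  positions-distinct i<j j≤n =
    applyUpTo-AllPairs⁻ P (suc n) (subst (AllPairs _≢_) (walk≡applyUpTo ss) (proj₂ saw)) i<j (s≤s j≤n)

  positions-inStrip : ∀ {j} → j ≤ n → inStrip (P j)
  positions-inStrip j≤n = AllP.applyUpTo⁻ P (suc n) (subst (All inStrip) (walk≡applyUpTo ss) (proj₁ saw)) (s≤s j≤n)

  visits-≤3 : ∀ {x ts} → AllPairs _<_ ts → All (_≤ n) ts → All (λ t → proj₁ (P t) ≡ x) ts → length ts ≤ 3
  visits-≤3 {x} {ts} ts-increasing ts≤n xs≡x = begin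
    length ts         ≡⟨ length-map P ts ⟨
    length (map P ts) ≤⟨ unique-⊆⇒length-≤ (distinct ts-increasing ts≤n) P[ts]⊆column ⟩
    3                 ∎
    where
    open ℕP.≤-Reasoning
    distinct : ∀ {ts} → AllPairs _<_ ts → All (_≤ n) ts → Unique (map P ts)
    distinct []               []          = []
    distinct (t<us ∷ us-inc) (_ ∷ us≤n) =
      AllP.map⁺ (All.zipWith (λ (t<u , u≤n) → positions-distinct t<u u≤n) (t<us , us≤n)) ∷ distinct us-inc us≤n
    P[ts]⊆column : map P ts ⊆ column x
    P[ts]⊆column p∈ with ∈-map⁻ P p∈
    ... | t , t∈ts , refl with All.lookup xs≡x t∈ts
    ...   | refl = inStrip⇒∈column (positions-inStrip (All.lookup ts≤n t∈ts))

module HalfSpace {n} {ss : Vec Step n} (hs : IsHalfSpace ss) where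
  open SelfAvoiding (proj₁ hs) public

  x-positive : ∀ {j} → 0 < j → j ≤ n → + 0 ℤ.< xAt (stepAt ss) j
  x-positive {suc j} _ 1+j≤n =
    AllP.applyUpTo⁻ _ n (subst (All (λ p → + 0 ℤ.< proj₁ p)) (pointsFrom≡applyUpTo origin ss) (proj₂ hs)) 1+j≤n

  x-nonneg : ∀ {j} → j ≤ n → + 0 ℤ.≤ xAt (stepAt ss) j
  x-nonneg {zero}  _   = ℤP.≤-refl
  x-nonneg {suc j} j≤n = ℤP.<⇒≤ (x-positive z<s j≤n)

isBridge-intro : ∀ {n} (v : Vec Step n) →
                 (∀ {i j} → i < j → j ≤ n → position (stepAt v) i ≢ position (stepAt v) j) →
                 (∀ {j} → j ≤ n → inStrip (position (stepAt v) j)) →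
                 (∀ {j} → 0 < j → j ≤ n → + 0 ℤ.< xAt (stepAt v) j × xAt (stepAt v) j ℤ.≤ xAt (stepAt v) n) →
                 IsBridge v
isBridge-intro {n} v distinct strip bounded = (allInStrip , allDistinct) , allBounded
  where
  V = position (stepAt v)
  allInStrip : All inStrip (walk v)
  allInStrip = subst (All inStrip) (sym (walk≡applyUpTo v))
    (AllP.applyUpTo⁺₁ V (suc n) (λ j<1+n → strip (ℕP.m<1+n⇒m≤n j<1+n)))
  allDistinct : AllPairs _≢_ (walk v)
  allDistinct = subst (AllPairs _≢_) (sym (walk≡applyUpTo v))
    (AllPairsP.applyUpTo⁺₁ V (suc n) (λ i<j j<1+n → distinct i<j (ℕP.m<1+n⇒m≤n j<1+n)))
  allBounded : All (λ p → (+ 0 ℤ.< proj₁ p) × (proj₁ p ℤ.≤ proj₁ (endpoint v))) (pointsFrom origin v)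
  allBounded = subst₂ (λ e → All (λ p → (+ 0 ℤ.< proj₁ p) × (proj₁ p ℤ.≤ proj₁ e)))
    (sym (last-pointsFrom origin v)) (sym (pointsFrom≡applyUpTo origin v))
    (AllP.applyUpTo⁺₁ (λ j → V (suc j)) n (bounded z<s))

-- Partitions into at most three distinct parts

record DistinctParts (a b c : ℕ) : Set where
  field
    c<b : 0 < c → c < b
    b<a : 0 < b → b < a

parts : ℕ → ℕ → ℕ → List ℕ
parts a       (suc b) (suc c) = a ∷ suc b ∷ suc c ∷ []
parts a       (suc b) zero    = a ∷ suc b ∷ []
parts zero    zero    _       = []
parts (suc a) zero    _       = suc a ∷ []

largestPart : List ℕ → ℕ
largestPart []      = 0
largestPart (x ∷ _) = x

secondPart : List ℕ → ℕ
secondPart (_ ∷ x ∷ _) = x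
secondPart _           = 0

largestPart-parts : ∀ a b c → largestPart (parts a b c) ≡ a
largestPart-parts a       (suc b) (suc c) = refl
largestPart-parts a       (suc b) zero    = refl
largestPart-parts zero    zero    _       = refl
largestPart-parts (suc a) zero    _       = refl

secondPart-parts : ∀ a b c → secondPart (parts a b c) ≡ b
secondPart-parts a       (suc b) (suc c) = refl
secondPart-parts a       (suc b) zero    = refl
secondPart-parts zero    zero    _       = refl
secondPart-parts (suc a) zero    _       = refl

sum-parts : ∀ a b c → DistinctParts a b c → sum (parts a b c) ≡ a + b + c
sum-parts a       (suc b) (suc c) _ =
  trans (cong (λ k → a + (suc b + k)) (ℕP.+-identityʳ (suc c))) (sym (ℕP.+-assoc a (suc b) (suc c)))
sum-parts a       (suc b) zero    _ = sym (ℕP.+-assoc a (suc b) 0)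
sum-parts zero    zero    zero    _ = refl
sum-parts (suc a) zero    zero    _ = sym (ℕP.+-identityʳ (suc a + 0))
sum-parts a       zero    (suc c) d = ⊥-elim (ℕP.n≮0 (DistinctParts.c<b d z<s))

parts-decreasing : ∀ a b c → DistinctParts a b c → AllPairs (λ x y → y < x) (parts a b c)
parts-decreasing a       (suc b) (suc c) d = (b<a z<s ∷ ℕP.<-trans (c<b z<s) (b<a z<s) ∷ []) ∷ (c<b z<s ∷ []) ∷ [] ∷ []
  where open DistinctParts d
parts-decreasing a       (suc b) zero    d = (DistinctParts.b<a d z<s ∷ []) ∷ [] ∷ []
parts-decreasing zero    zero    _       _ = []
parts-decreasing (suc a) zero    _       _ = [] ∷ []

parts-positive : ∀ a b c → DistinctParts a b c → All (0 <_) (parts a b c)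
parts-positive a       (suc b) (suc c) d = ℕP.<-trans z<s (DistinctParts.b<a d z<s) ∷ z<s ∷ z<s ∷ []
parts-positive a       (suc b) zero    d = ℕP.<-trans z<s (DistinctParts.b<a d z<s) ∷ z<s ∷ []
parts-positive zero    zero    _       _ = []
parts-positive (suc a) zero    _       _ = z<s ∷ []

length-parts : ∀ a b c → length (parts a b c) ≤ 3
length-parts a       (suc b) (suc c) = ℕP.≤-refl
length-parts a       (suc b) zero    = s≤s (s≤s z≤n)
length-parts zero    zero    _       = z≤n
length-parts (suc a) zero    _       = s≤s z≤n

∈⇒≤sum : ∀ {x xs} → x ∈ xs → x ≤ sum xs
∈⇒≤sum {xs = x ∷ xs} (here refl) = ℕP.m≤m+n x (sum xs)
∈⇒≤sum {xs = y ∷ xs} (there x∈) = ℕP.≤-trans (∈⇒≤sum x∈) (ℕP.m≤n+m (sum xs) y)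

∈-listsUpTo : ∀ A k {xs} → length xs ≤ k → All (λ x → 0 < x × x ≤ A) xs → xs ∈ listsUpTo A k
∈-listsUpTo A zero    {[]}         _            _                   = here refl
∈-listsUpTo A (suc k) {[]}         _            _                   = here refl
∈-listsUpTo A (suc k) {zero ∷ xs}  _            ((() , _) ∷ _)
∈-listsUpTo A (suc k) {suc x ∷ xs} (s≤s |xs|≤k) ((_ , 1+x≤A) ∷ xs-ok) =
  there (∈-concatMap⁺ (λ y → map (y ∷_) (listsUpTo A k))
    (lose (∈-map⁺ suc (∈-upTo⁺ 1+x≤A)) (∈-map⁺ (suc x ∷_) (∈-listsUpTo A k |xs|≤k xs-ok))))

parts-∈-partitions : ∀ {A} a b c → DistinctParts a b c → a + b + c ≡ A →
                     parts a b c ∈ filter (IsDistinctPartition? A) (listsUpTo A 3)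
parts-∈-partitions {A} a b c d a+b+c≡A = ∈-filter⁺ (IsDistinctPartition? A)
  (∈-listsUpTo A 3 (length-parts a b c) (All.tabulate (λ {x} x∈ → All.lookup (parts-positive a b c d) x∈ , bound x∈)))
  (sum≡A , parts-decreasing a b c d)
  where
  sum≡A : sum (parts a b c) ≡ A
  sum≡A = trans (sum-parts a b c d) a+b+c≡A
  bound : ∀ {x} → x ∈ parts a b c → x ≤ A
  bound x∈ = subst (_ ≤_) sum≡A (∈⇒≤sum x∈)

-- Unfolding a half-space walk into a bridge

mirrorOn : ℕ → ℕ → ℕ → Step → Step
mirrorOn a b j s with a ≤? j | j <? b
... | yes _ | yes _ = mirror s
... | _     | _     = s

mirrorOn-involutive : ∀ a b j s → mirrorOn a b j (mirrorOn a b j s) ≡ s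
mirrorOn-involutive a b j s with a ≤? j | j <? b
... | yes _ | yes _ = mirror-involutive s
... | yes _ | no _  = refl
... | no _  | yes _ = refl
... | no _  | no _  = refl

mirrorOn-inside : ∀ {a b j} s → a ≤ j → j < b → mirrorOn a b j s ≡ mirror s
mirrorOn-inside {a} {b} {j} s a≤j j<b with a ≤? j | j <? b
... | yes _ | yes _   = refl
... | no a≰j | _      = ⊥-elim (a≰j a≤j)
... | yes _ | no j≮b  = ⊥-elim (j≮b j<b)

mirrorOn-before : ∀ {a b j} s → j < a → mirrorOn a b j s ≡ s
mirrorOn-before {a} {b} {j} s j<a with a ≤? j | j <? b
... | yes a≤j | yes _ = ⊥-elim (ℕP.<⇒≱ j<a a≤j)
... | yes _   | no _  = refl
... | no _    | _     = refl

mirrorOn-after : ∀ {a b j} s → b ≤ j → mirrorOn a b j s ≡ s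
mirrorOn-after {a} {b} {j} s b≤j with a ≤? j | j <? b
... | yes _ | yes j<b = ⊥-elim (ℕP.<⇒≱ j<b b≤j)
... | yes _ | no _    = refl
... | no _  | _       = refl

span : ∀ {n} → Vec Step n → ℕ
span {n} v = ∣ xAt (stepAt v) n ∣

slack : ∀ {n} → Vec Step n → ℕ
slack {n} v = n ∸ span v

-- The lines x = M₁ and x = 2M₁ - m₂ of an unfolding, read back from its code.
level₁ level₂ : ∀ {n} → List ℕ × Vec Step n → ℤ
level₁ (ps , v) = + (largestPart ps ∸ slack v)
level₂ (ps , v) = level₁ (ps , v) ℤ.+ + secondPart ps

module Unfolding {n} (ss : Vec Step n) where

  f : ℕ → Step
  f = stepAt ss

  P : ℕ → Point
  P = position f

  X : ℕ → ℤ
  X = xAt f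

  max₁ : ∃[ i ] IsLastMax X 0 n i
  max₁ = lastMax-exists X z≤n

  n₁ : ℕ
  n₁ = proj₁ max₁

  min₂ : ∃[ i ] IsLastMin X n₁ n i
  min₂ = lastMin-exists X (IsLastExtremum.i≤n (proj₂ max₁))

  n₂ : ℕ
  n₂ = proj₁ min₂

  open IsLastExtremum (proj₂ max₁) public using () renaming (i≤n to n₁≤n; extreme to ≤M₁; strict to <M₁)
  open IsLastExtremum (proj₂ min₂) public using () renaming (lo≤i to n₁≤n₂; i≤n to n₂≤n; extreme to m₂≤; strict to m₂<)

  M₁ m₂ L₂ : ℤ
  M₁ = X n₁
  m₂ = X n₂
  L₂ = M₁ ℤ.+ M₁ ℤ.- m₂

  unfolded : ℕ → Step
  unfolded j = mirrorOn n₁ n₂ j (f j)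

  bridge : Vec Step n
  bridge = fromSteps n unfolded

  Q : ℕ → Point
  Q = position unfolded

  XQ : ℕ → ℤ
  XQ = xAt unfolded

  Q-initial : ∀ {j} → j ≤ n₁ → Q j ≡ P j
  Q-initial {j} j≤n₁ = positionFrom-cong origin j (λ i<j → mirrorOn-before _ (ℕP.<-≤-trans i<j j≤n₁))

  Q-middle : ∀ {j} → n₁ ≤ j → j ≤ n₂ → Q j ≡ reflectX (M₁ ℤ.+ M₁) (P j)
  Q-middle = position-conjugate (reflectX (M₁ ℤ.+ M₁)) mirror (move-reflectX (M₁ ℤ.+ M₁))
    (mirrorOn-inside _) (trans (Q-initial ℕP.≤-refl) (cong (_, proj₂ (P n₁)) (sym (i+i-i≡i M₁))))

  Q-final : ∀ {j} → n₂ ≤ j → Q j ≡ translateX (L₂ ℤ.- m₂) (P j)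
  Q-final n₂≤j = position-conjugate (translateX (L₂ ℤ.- m₂)) (λ s → s) (move-translateX (L₂ ℤ.- m₂))
    (λ n₂≤i _ → mirrorOn-after {n₁} _ n₂≤i)
    (trans (Q-middle n₁≤n₂ ℕP.≤-refl) (cong (_, proj₂ (P n₂)) (sym (i-j+j≡i L₂ m₂))))
    n₂≤j ℕP.≤-refl

  position-bridge : ∀ {j} → j ≤ n → position (stepAt bridge) j ≡ Q j
  position-bridge {j} j≤n = positionFrom-cong origin j (λ i<j → stepAt-fromSteps n unfolded (ℕP.<-≤-trans i<j j≤n))

  steps-from-bridge : ∀ {j} → j < n → f j ≡ mirrorOn n₁ n₂ j (stepAt bridge j)
  steps-from-bridge {j} j<n = begin
    f j                              ≡⟨ mirrorOn-involutive n₁ n₂ j (f j) ⟨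
    mirrorOn n₁ n₂ j (unfolded j)    ≡⟨ cong (mirrorOn n₁ n₂ j) (stepAt-fromSteps n unfolded j<n) ⟨
    mirrorOn n₁ n₂ j (stepAt bridge j) ∎
    where open ≡-Reasoning

  A₁ A₂ A₃ : ℕ
  A₁ = ∣ M₁ ∣
  A₂ = ∣ M₁ ℤ.- m₂ ∣
  A₃ = ∣ X n ℤ.- m₂ ∣

  code : List ℕ × Vec Step n
  code = parts (A₁ + slack bridge) A₂ A₃ , bridge

  module OfHalfSpace (hs : IsHalfSpace ss) where
    open HalfSpace hs

    m₂≤M₁ : m₂ ℤ.≤ M₁
    m₂≤M₁ = m₂≤ ℕP.≤-refl n₁≤n

    m₂≤Xn : m₂ ℤ.≤ X n
    m₂≤Xn = m₂≤ n₁≤n ℕP.≤-refl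

    M₁≤L₂ : M₁ ℤ.≤ L₂
    M₁≤L₂ = subst (ℤ._≤ L₂) (i+i-i≡i M₁) (reflect-≤ (M₁ ℤ.+ M₁) m₂≤M₁)

    -- Otherwise, with n₃ the last maximum after n₂, the value z = X (n₃ + 1) is attained on each of
    -- the stretches before n₁, between n₁ and n₂, between n₂ and n₃, and at n₃ + 1: four visits to x = z.
    X-after-n₂-≤-end : ∀ {j} → n₂ ≤ j → j ≤ n → X j ℤ.≤ X n
    X-after-n₂-≤-end {j} n₂≤j j≤n with X j ℤ.≤? X n
    ... | yes Xj≤Xn = Xj≤Xn
    ... | no Xj≰Xn with lastMax-exists X n₂≤n
    ...   | n₃ , max₃ = ⊥-elim (ℕP.<-irrefl refl (visits-≤3 increasing bounded (Xj₁≡z ∷ Xj₂≡z ∷ Xj₃≡z ∷ refl ∷ [])))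
      where
      open IsLastExtremum max₃ renaming (lo≤i to n₂≤n₃; i≤n to n₃≤n; extreme to ≤Xn₃; strict to <Xn₃)
      Xn<Xn₃ : X n ℤ.< X n₃
      Xn<Xn₃ = ℤP.<-≤-trans (ℤP.≰⇒> Xj≰Xn) (≤Xn₃ n₂≤j j≤n)
      n₃<n : n₃ < n
      n₃<n = ℕP.≤∧≢⇒< n₃≤n (λ { refl → ℤP.<-irrefl refl Xn<Xn₃ })
      z : ℤ
      z = X (suc n₃)
      z<Xn₃ : z ℤ.< X n₃
      z<Xn₃ = <Xn₃ (ℕP.n<1+n n₃) n₃<n
      m₂<z : m₂ ℤ.< z
      m₂<z = m₂< (s≤s n₂≤n₃) n₃<n
      z<M₁ : z ℤ.< M₁
      z<M₁ = <M₁ (s≤s (ℕP.≤-trans n₁≤n₂ n₂≤n₃)) n₃<n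
      open AttainedWithin (ivt-< X (xAt-suc-≤ f) {b = n₁} z≤n (ℤP.≤-<-trans (x-nonneg n₂≤n) m₂<z) z<M₁)
        renaming (time to j₁; before to j₁<n₁; value to Xj₁≡z)
      open AttainedWithin (ivt-down-< X (xAt-suc-≥ f) {n₁} {n₂} n₁≤n₂ m₂<z z<M₁)
        renaming (time to j₂; after to n₁<j₂; before to j₂<n₂; value to Xj₂≡z)
      open AttainedWithin (ivt-< X (xAt-suc-≤ f) {n₂} {n₃} n₂≤n₃ m₂<z z<Xn₃)
        renaming (time to j₃; after to n₂<j₃; before to j₃<n₃; value to Xj₃≡z)
      increasing : AllPairs _<_ (j₁ ∷ j₂ ∷ j₃ ∷ suc n₃ ∷ [])
      increasing = Linked⇒AllPairs ℕP.<-trans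
        (ℕP.<-trans j₁<n₁ n₁<j₂ ∷ ℕP.<-trans j₂<n₂ n₂<j₃ ∷ ℕP.<-trans j₃<n₃ (ℕP.n<1+n n₃) ∷ [-])
      bounded : All (_≤ n) (j₁ ∷ j₂ ∷ j₃ ∷ suc n₃ ∷ [])
      bounded = ℕP.<⇒≤ (ℕP.<-≤-trans j₁<n₁ n₁≤n) ∷ ℕP.<⇒≤ (ℕP.<-≤-trans j₂<n₂ n₂≤n)
              ∷ ℕP.<⇒≤ (ℕP.<-trans j₃<n₃ n₃<n) ∷ n₃<n ∷ []

    XQ-initial : ∀ {j} → j ≤ n₁ → XQ j ≡ X j
    XQ-initial j≤n₁ = cong proj₁ (Q-initial j≤n₁)

    XQ-middle : ∀ {j} → n₁ ≤ j → j ≤ n₂ → XQ j ≡ M₁ ℤ.+ M₁ ℤ.- X j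
    XQ-middle n₁≤j j≤n₂ = cong proj₁ (Q-middle n₁≤j j≤n₂)

    XQ-final : ∀ {j} → n₂ ≤ j → XQ j ≡ L₂ ℤ.- m₂ ℤ.+ X j
    XQ-final n₂≤j = cong proj₁ (Q-final n₂≤j)

    crossing₂ : IsCrossing XQ n L₂ n₂
    crossing₂ = record { a≤n = n₂≤n ; below = below ; above = above }
      where
      below : ∀ {j} → j ≤ n₂ → XQ j ℤ.≤ L₂
      below {j} j≤n₂ with j ≤? n₁
      ... | yes j≤n₁ = subst (ℤ._≤ L₂) (sym (XQ-initial j≤n₁)) (ℤP.≤-trans (≤M₁ z≤n (ℕP.≤-trans j≤n₁ n₁≤n)) M₁≤L₂)
      ... | no j≰n₁  = subst (ℤ._≤ L₂) (sym (XQ-middle n₁≤j j≤n₂))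
                         (reflect-≤ (M₁ ℤ.+ M₁) (m₂≤ n₁≤j (ℕP.≤-trans j≤n₂ n₂≤n)))
        where n₁≤j = ℕP.≰⇒≥ j≰n₁
      above : ∀ {j} → n₂ < j → j ≤ n → L₂ ℤ.< XQ j
      above n₂<j j≤n = subst (L₂ ℤ.<_) (sym (XQ-final (ℕP.<⇒≤ n₂<j))) (translate-< L₂ (m₂< n₂<j j≤n))

    crossing₁ : IsCrossing XQ n M₁ n₁
    crossing₁ = record { a≤n = n₁≤n ; below = below ; above = above }
      where
      below : ∀ {j} → j ≤ n₁ → XQ j ℤ.≤ M₁
      below j≤n₁ = subst (ℤ._≤ M₁) (sym (XQ-initial j≤n₁)) (≤M₁ z≤n (ℕP.≤-trans j≤n₁ n₁≤n))
      above : ∀ {j} → n₁ < j → j ≤ n → M₁ ℤ.< XQ j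
      above {j} n₁<j j≤n with j ≤? n₂
      ... | yes j≤n₂ = subst₂ ℤ._<_ (i+i-i≡i M₁) (sym (XQ-middle (ℕP.<⇒≤ n₁<j) j≤n₂))
                         (reflect-< (M₁ ℤ.+ M₁) (<M₁ n₁<j j≤n))
      ... | no j≰n₂  = ℤP.≤-<-trans M₁≤L₂ (IsCrossing.above crossing₂ (ℕP.≰⇒> j≰n₂) j≤n)

    distinct-across : ∀ {L a i j} → IsCrossing XQ n L a → i ≤ a → a < j → j ≤ n → Q i ≢ Q j
    distinct-across crossing i≤a a<j j≤n = crossing-separates crossing i≤a a<j j≤n ∘ cong proj₁

    distinct-within : ∀ {σ : Point → Point} {i j} → (∀ {p q} → σ p ≡ σ q → p ≡ q) →
                      Q i ≡ σ (P i) → Q j ≡ σ (P j) → i < j → j ≤ n → Q i ≢ Q j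
    distinct-within σ-injective Qi≡σPi Qj≡σPj i<j j≤n Qi≡Qj =
      positions-distinct i<j j≤n (σ-injective (trans (sym Qi≡σPi) (trans Qi≡Qj Qj≡σPj)))

    Q-distinct : ∀ {i j} → i < j → j ≤ n → Q i ≢ Q j
    Q-distinct {i} {j} i<j j≤n with j ≤? n₁ | i ≤? n₁ | j ≤? n₂ | i ≤? n₂
    ... | yes j≤n₁ | _        | _        | _        =
      distinct-within (λ p≡q → p≡q) (Q-initial (ℕP.≤-trans (ℕP.<⇒≤ i<j) j≤n₁)) (Q-initial j≤n₁) i<j j≤n
    ... | no j≰n₁  | yes i≤n₁ | _        | _        = distinct-across crossing₁ i≤n₁ (ℕP.≰⇒> j≰n₁) j≤n
    ... | no _     | no i≰n₁  | yes j≤n₂ | _        =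
      distinct-within (reflectX-injective (M₁ ℤ.+ M₁))
        (Q-middle (ℕP.≰⇒≥ i≰n₁) (ℕP.≤-trans (ℕP.<⇒≤ i<j) j≤n₂))
        (Q-middle (ℕP.≤-trans (ℕP.≰⇒≥ i≰n₁) (ℕP.<⇒≤ i<j)) j≤n₂) i<j j≤n
    ... | no _     | no _     | no j≰n₂  | yes i≤n₂ = distinct-across crossing₂ i≤n₂ (ℕP.≰⇒> j≰n₂) j≤n
    ... | no _     | no _     | no j≰n₂  | no i≰n₂  =
      distinct-within (translateX-injective (L₂ ℤ.- m₂)) (Q-final (ℕP.≰⇒≥ i≰n₂)) (Q-final (ℕP.≰⇒≥ j≰n₂)) i<j j≤n

    Q-y : ∀ j → proj₂ (Q j) ≡ proj₂ (P j)
    Q-y j with j ≤? n₁ | j ≤? n₂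
    ... | yes j≤n₁ | _        = cong proj₂ (Q-initial j≤n₁)
    ... | no j≰n₁  | yes j≤n₂ = cong proj₂ (Q-middle (ℕP.≰⇒≥ j≰n₁) j≤n₂)
    ... | no _     | no j≰n₂  = cong proj₂ (Q-final (ℕP.≰⇒≥ j≰n₂))

    Q-inStrip : ∀ {j} → j ≤ n → inStrip (Q j)
    Q-inStrip {j} j≤n = subst (λ y → (-[1+ 0 ] ℤ.≤ y) × (y ℤ.≤ + 1)) (sym (Q-y j)) (positions-inStrip j≤n)

    XQ-bounded : ∀ {j} → 0 < j → j ≤ n → (+ 0 ℤ.< XQ j) × (XQ j ℤ.≤ XQ n)
    XQ-bounded {j} 0<j j≤n = positive , subst (XQ j ℤ.≤_) (sym (XQ-final n₂≤n)) ≤end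
      where
      positive : + 0 ℤ.< XQ j
      positive with j ≤? n₁
      ... | yes j≤n₁ = subst (+ 0 ℤ.<_) (sym (XQ-initial j≤n₁)) (x-positive 0<j j≤n)
      ... | no j≰n₁  = ℤP.≤-<-trans (≤M₁ z≤n z≤n) (IsCrossing.above crossing₁ (ℕP.≰⇒> j≰n₁) j≤n)
      ≤end : XQ j ℤ.≤ L₂ ℤ.- m₂ ℤ.+ X n
      ≤end with j ≤? n₂
      ... | yes j≤n₂ = ℤP.≤-trans (IsCrossing.below crossing₂ j≤n₂) (translate-≤ L₂ m₂≤Xn)
      ... | no j≰n₂  = subst (ℤ._≤ L₂ ℤ.- m₂ ℤ.+ X n) (sym (XQ-final n₂≤j))
                         (ℤP.+-monoʳ-≤ (L₂ ℤ.- m₂) (X-after-n₂-≤-end n₂≤j j≤n))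
        where n₂≤j = ℕP.≰⇒≥ j≰n₂

    isBridge : IsBridge bridge
    isBridge = isBridge-intro bridge distinct strip bounded
      where
      distinct : ∀ {i j} → i < j → j ≤ n → position (stepAt bridge) i ≢ position (stepAt bridge) j
      distinct i<j j≤n rewrite position-bridge j≤n | position-bridge (ℕP.<⇒≤ (ℕP.<-≤-trans i<j j≤n)) =
        Q-distinct i<j j≤n
      strip : ∀ {j} → j ≤ n → inStrip (position (stepAt bridge) j)
      strip j≤n rewrite position-bridge j≤n = Q-inStrip j≤n
      bounded : ∀ {j} → 0 < j → j ≤ n →
                (+ 0 ℤ.< xAt (stepAt bridge) j) × (xAt (stepAt bridge) j ℤ.≤ xAt (stepAt bridge) n)
      bounded 0<j j≤n rewrite position-bridge j≤n | position-bridge {n} ℕP.≤-refl = XQ-bounded 0<j j≤n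

    +A₁≡M₁ : + A₁ ≡ M₁
    +A₁≡M₁ = ℤP.0≤i⇒+∣i∣≡i (≤M₁ z≤n z≤n)

    +A₂≡M₁-m₂ : + A₂ ≡ M₁ ℤ.- m₂
    +A₂≡M₁-m₂ = ℤP.0≤i⇒+∣i∣≡i (ℤP.i≤j⇒0≤j-i m₂≤M₁)

    +A₃≡Xn-m₂ : + A₃ ≡ X n ℤ.- m₂
    +A₃≡Xn-m₂ = ℤP.0≤i⇒+∣i∣≡i (ℤP.i≤j⇒0≤j-i m₂≤Xn)

    bridge-end : xAt (stepAt bridge) n ≡ L₂ ℤ.- m₂ ℤ.+ X n
    bridge-end = trans (cong proj₁ (position-bridge ℕP.≤-refl)) (XQ-final n₂≤n)

    +span≡bridge-end : + span bridge ≡ xAt (stepAt bridge) n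
    +span≡bridge-end = ℤP.0≤i⇒+∣i∣≡i (subst (+ 0 ℤ.≤_) (sym bridge-end)
      (ℤP.≤-trans (≤M₁ z≤n z≤n) (ℤP.≤-trans M₁≤L₂ (translate-≤ L₂ m₂≤Xn))))

    span≡A₁+A₂+A₃ : span bridge ≡ A₁ + A₂ + A₃
    span≡A₁+A₂+A₃ = ℤP.+-injective (begin
      + span bridge                                    ≡⟨ +span≡bridge-end ⟩
      xAt (stepAt bridge) n                            ≡⟨ bridge-end ⟩
      M₁ ℤ.+ M₁ ℤ.- m₂ ℤ.- m₂ ℤ.+ X n                  ≡⟨ rearrange M₁ m₂ (X n) ⟩
      M₁ ℤ.+ (M₁ ℤ.- m₂) ℤ.+ (X n ℤ.- m₂)              ≡⟨ cong₂ ℤ._+_ (cong₂ ℤ._+_ +A₁≡M₁ +A₂≡M₁-m₂) +A₃≡Xn-m₂ ⟨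
      + (A₁ + A₂ + A₃)                                 ∎)
      where
      open ≡-Reasoning
      rearrange : ∀ M m x → M ℤ.+ M ℤ.- m ℤ.- m ℤ.+ x ≡ M ℤ.+ (M ℤ.- m) ℤ.+ (x ℤ.- m)
      rearrange = solve-∀

    code-sum : A₁ + slack bridge + A₂ + A₃ ≡ n
    code-sum = begin
      A₁ + slack bridge + A₂ + A₃     ≡⟨ rearrange A₁ (slack bridge) A₂ A₃ ⟩
      A₁ + A₂ + A₃ + slack bridge     ≡⟨ cong (_+ slack bridge) span≡A₁+A₂+A₃ ⟨
      span bridge + (n ∸ span bridge) ≡⟨ ℕP.m+[n∸m]≡n span≤n ⟩
      n                               ∎
      where
      open ≡-Reasoning
      rearrange : ∀ a s b c → a + s + b + c ≡ a + b + c + s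
      rearrange = ℕ-Ring.solve-∀
      span≤n : span bridge ≤ n
      span≤n = ℤP.drop‿+≤+ (subst (ℤ._≤ + n) (sym +span≡bridge-end) (xAt-≤-time (stepAt bridge) n))

    code-distinct : DistinctParts (A₁ + slack bridge) A₂ A₃
    code-distinct = record { c<b = A₃<A₂ ; b<a = A₂<A₁+slack }
      where
      A₃<A₂ : 0 < A₃ → A₃ < A₂
      A₃<A₂ 0<A₃ = ℤP.drop‿+<+ (subst₂ ℤ._<_ (sym +A₃≡Xn-m₂) (sym +A₂≡M₁-m₂) (ℤP.+-monoˡ-< (- m₂) Xn<M₁))
        where
        m₂<Xn : m₂ ℤ.< X n
        m₂<Xn = 0<i-j⇒j<i (subst (+ 0 ℤ.<_) +A₃≡Xn-m₂ (ℤ.+<+ 0<A₃))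
        n₂<n : n₂ < n
        n₂<n = ℕP.≤∧≢⇒< n₂≤n (λ n₂≡n → ℤP.<-irrefl (cong X n₂≡n) m₂<Xn)
        Xn<M₁ : X n ℤ.< M₁
        Xn<M₁ = <M₁ (ℕP.≤-<-trans n₁≤n₂ n₂<n) ℕP.≤-refl
      A₂<A₁+slack : 0 < A₂ → A₂ < A₁ + slack bridge
      A₂<A₁+slack 0<A₂ =
        ℕP.<-≤-trans (ℤP.drop‿+<+ (subst₂ ℤ._<_ (sym +A₂≡M₁-m₂) (sym +A₁≡M₁) M₁-m₂<M₁)) (ℕP.m≤m+n A₁ (slack bridge))
        where
        m₂<M₁ : m₂ ℤ.< M₁
        m₂<M₁ = 0<i-j⇒j<i (subst (+ 0 ℤ.<_) +A₂≡M₁-m₂ (ℤ.+<+ 0<A₂))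
        n₁<n₂ : n₁ < n₂
        n₁<n₂ = ℕP.≤∧≢⇒< n₁≤n₂ (λ n₁≡n₂ → ℤP.<-irrefl (cong X (sym n₁≡n₂)) m₂<M₁)
        M₁-m₂<M₁ : M₁ ℤ.- m₂ ℤ.< M₁
        M₁-m₂<M₁ = subst (M₁ ℤ.- m₂ ℤ.<_) (ℤP.+-identityʳ M₁) (reflect-< M₁ (x-positive (ℕP.≤-<-trans z≤n n₁<n₂) n₂≤n))

    level₁-code : level₁ code ≡ M₁
    level₁-code = begin
      level₁ code                          ≡⟨ cong (λ a → + (a ∸ slack bridge)) (largestPart-parts _ A₂ A₃) ⟩
      + (A₁ + slack bridge ∸ slack bridge) ≡⟨ cong +_ (ℕP.m+n∸n≡m A₁ (slack bridge)) ⟩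
      + A₁                                 ≡⟨ +A₁≡M₁ ⟩
      M₁                                   ∎
      where open ≡-Reasoning

    level₂-code : level₂ code ≡ L₂
    level₂-code = begin
      level₂ code        ≡⟨ cong₂ (λ M a → M ℤ.+ + a) level₁-code (secondPart-parts _ A₂ A₃) ⟩
      M₁ ℤ.+ + A₂        ≡⟨ cong (λ x → M₁ ℤ.+ x) +A₂≡M₁-m₂ ⟩
      M₁ ℤ.+ (M₁ ℤ.- m₂) ≡⟨ ℤP.+-assoc M₁ M₁ (- m₂) ⟨
      L₂                 ∎
      where open ≡-Reasoning

    bridge-crossing₁ : IsCrossing (xAt (stepAt bridge)) n (level₁ code) n₁
    bridge-crossing₁ = subst (λ L → IsCrossing (xAt (stepAt bridge)) n L n₁) (sym level₁-code)
      (crossing-transport (λ j≤n → cong proj₁ (sym (position-bridge j≤n))) crossing₁)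

    bridge-crossing₂ : IsCrossing (xAt (stepAt bridge)) n (level₂ code) n₂
    bridge-crossing₂ = subst (λ L → IsCrossing (xAt (stepAt bridge)) n L n₂) (sym level₂-code)
      (crossing-transport (λ j≤n → cong proj₁ (sym (position-bridge j≤n))) crossing₂)

encode : ∀ {n} → Vec Step n → List ℕ × Vec Step n
encode = Unfolding.code

encode-∈ : ∀ {n} {ss : Vec Step n} → IsHalfSpace ss →
           encode ss ∈ cartesianProduct (filter (IsDistinctPartition? n) (listsUpTo n 3)) (filter IsBridge? (allSteps n))
encode-∈ {ss = ss} hs = ∈-cartesianProduct⁺
  (parts-∈-partitions (A₁ + slack bridge) A₂ A₃ code-distinct code-sum)
  (∈-filter⁺ IsBridge? (allSteps-complete bridge) isBridge)
  where
  open Unfolding ss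
  open OfHalfSpace hs

encode-injective : ∀ {n} {s t : Vec Step n} → IsHalfSpace s → IsHalfSpace t → encode s ≡ encode t → s ≡ t
encode-injective {n} {s} {t} hs ht code≡ = stepAt-injective s t λ {j} j<n → begin
  stepAt s j                               ≡⟨ U.steps-from-bridge j<n ⟩
  mirrorOn U.n₁ U.n₂ j (stepAt U.bridge j) ≡⟨ cong₂ (λ a b → mirrorOn a b j (stepAt U.bridge j)) n₁≡ n₂≡ ⟩
  mirrorOn V.n₁ V.n₂ j (stepAt U.bridge j) ≡⟨ cong (λ w → mirrorOn V.n₁ V.n₂ j (stepAt w j)) (cong proj₂ code≡) ⟩
  mirrorOn V.n₁ V.n₂ j (stepAt V.bridge j) ≡⟨ V.steps-from-bridge j<n ⟨
  stepAt t j                               ∎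
  where
  open ≡-Reasoning
  module U = Unfolding s
  module V = Unfolding t
  n₁≡ : U.n₁ ≡ V.n₁
  n₁≡ = crossing-unique (U.OfHalfSpace.bridge-crossing₁ hs)
    (subst (λ c → IsCrossing (xAt (stepAt (proj₂ c))) n (level₁ c) V.n₁) (sym code≡) (V.OfHalfSpace.bridge-crossing₁ ht))
  n₂≡ : U.n₂ ≡ V.n₂
  n₂≡ = crossing-unique (U.OfHalfSpace.bridge-crossing₂ hs)
    (subst (λ c → IsCrossing (xAt (stepAt (proj₂ c))) n (level₂ c) V.n₂) (sym code≡) (V.OfHalfSpace.bridge-crossing₂ ht))

mainTheorem7 : (n : ℕ) → h n ≤ PF n * b n
mainTheorem7 n = begin
  h n                                          ≤⟨ injectiveOn⇒length-≤ encode encode-injective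
                                                    (AllP.all-filter IsHalfSpace? (allSteps n))
                                                    (UniqueP.filter⁺ IsHalfSpace? (allSteps-unique n))
                                                    (λ ss∈ → encode-∈ (proj₂ (∈-filter⁻ IsHalfSpace? {xs = allSteps n} ss∈))) ⟩
  length (cartesianProduct partitions bridges) ≡⟨ length-cartesianProduct partitions bridges ⟩
  PF n * b n                                   ∎
  where
  open ℕP.≤-Reasoning
  partitions = filter (IsDistinctPartition? n) (listsUpTo n 3)
  bridges = filter IsBridge? (allSteps n)
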